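{- Let $j\geqslant1$, let $u$ be a finite word over $\{{\tt a},{\tt b}\}$ of length $2j$ containing exactly $j$ letters ${\tt a}$ and $j$ letters ${\tt b}$, and let ${\tt w}_j=u{\tt f}$ be the word obtained from the Fibonacci word ${\tt f}$ by attaching the prefix $u$. Then $r_{{\tt w}_j}(n)=n-j$ for all $n>j$. Moreover, if $u=({\tt a}{\tt b})^j$, then $r_{{\tt w}_j}(1)=r_{{\tt w}_j}(2)=\cdots=r_{{\tt w}_j}(j)=1$.
   Context: The Fibonacci word ${\tt f}$ is the fixed point of $\varrho_F:{\tt a}\mapsto{\tt a}{\tt b},\ {\tt b}\mapsto{\tt a}$. Words are indexed from position $0$; $p_{\tt a}(n)$, $p_{\tt b}(n)$ are the positions of the $n$-th ${\tt a}$ and $n$-th ${\tt b}$ and $r(n)=p_{\tt b}(n)-p_{\tt a}(n)$. -}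

module Defs where

open import Data.Nat using (ℕ; zero; suc; _+_; _*_)
open import Data.List using (List; []; _∷_; _++_; concat; replicate; length)
open import Data.Product using (Σ; _×_; _,_)
open import Data.Integer using (ℤ; +_; _-_)
open import Relation.Binary.PropositionalEquality using (_≡_)

data Letter : Set where
  𝕒 𝕓 : Letter

_==_ : Letter → Letter → ℕ
𝕒 == 𝕒 = 1
𝕓 == 𝕓 = 1
𝕒 == 𝕓 = 0
𝕓 == 𝕒 = 0

ϱF : List Letter → List Letter
ϱF [] = []
ϱF (𝕒 ∷ w) = 𝕒 ∷ 𝕓 ∷ ϱF w
ϱF (𝕓 ∷ w) = 𝕒 ∷ ϱF w

iterϱ : ℕ → List Letter
iterϱ zero = 𝕒 ∷ []
iterϱ (suc k) = ϱF (iterϱ k)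

-- i-th letter of a finite word (default 𝕒 out of range; never used out of range below)
nth : List Letter → ℕ → Letter
nth [] _ = 𝕒
nth (x ∷ w) zero = x
nth (x ∷ w) (suc i) = nth w i

-- Fibonacci word f (infinite word, positions from 0): the fixed point of ϱF,
-- f(i) = i-th letter of ϱF^(i+1)(a); ϱF^k(a) is a prefix of f of length F_{k+2} > i.
fib : ℕ → Letter
fib i = nth (iterϱ (suc i)) i

prepend : List Letter → (ℕ → Letter) → ℕ → Letter
prepend [] f i = f i
prepend (x ∷ u) f zero = x
prepend (x ∷ u) f (suc i) = prepend u f i

countL : Letter → List Letter → ℕ
countL c [] = 0
countL c (x ∷ w) = (c == x) + countL c w

countUpTo : Letter → (ℕ → Letter) → ℕ → ℕ
countUpTo c w zero = 0
countUpTo c w (suc m) = countUpTo c w m + (c == w m)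

-- m is the position of the n-th occurrence (n ≥ 1) of letter c in w, i.e. p_c(n) = m
IsNthPos : (ℕ → Letter) → Letter → ℕ → ℕ → Set
IsNthPos w c n m = (w m ≡ c) × (suc (countUpTo c w m) ≡ n)

-- r_w(n) = p_b(n) - p_a(n) is defined and equals r
RIs : (ℕ → Letter) → ℕ → ℤ → Set
RIs w n r = Σ ℕ λ pa → Σ ℕ λ pb →
  IsNthPos w 𝕒 n pa × IsNthPos w 𝕓 n pb × ((+ pb) - (+ pa) ≡ r)

abPow : ℕ → List Letter
abPow j = concat (replicate j (𝕒 ∷ 𝕓 ∷ []))

module Submission where

-- Since f = ϱF(f), position i of f carries the block ϱF(f i), which starts at
-- P(i) = i + |f[0,i)|_𝕒 and begins with 𝕒; so the n-th 𝕒 of f sits at P(n-1).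
-- That 𝕒 in turn produces the block 𝕒𝕓, whose 𝕓 at P(P(n-1)) + 1 is preceded by
-- |f[0,P(n-1))|_𝕒 = n-1 letters 𝕓, hence is the n-th 𝕓. As P(P(n-1)) = P(n-1) + n-1,
-- r_f(n) = n. Prepending u with j letters of each kind moves every occurrence
-- by |u| and renumbers it by j, so r_{uf}(j + n) = r_f(n); for u = (𝕒𝕓)^j the first
-- j occurrences of each letter are those inside u.

open import Defs
open import Data.Nat using (ℕ; zero; suc; _+_; _*_; _∸_; _≤_; _<_; _≤′_; ≤′-refl; ≤′-step; s≤s; z≤n)
open import Data.Nat.Properties
open import Algebra.Properties.CommutativeSemigroup +-commutativeSemigroup using (interchange)
open import Data.List using (List; []; _∷_; _++_; length)
open import Data.List.Properties using (++-identityʳ)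
open import Data.Product using (_×_; Σ; _,_)
open import Data.Integer using (+_; _-_; _⊖_)
open import Data.Integer.Properties using (m-n≡m⊖n; ⊖-≥; +-cancelˡ-⊖)
open import Relation.Binary.PropositionalEquality
open ≡-Reasoning

countUpTo-suc : ∀ c (g : ℕ → Letter) n →
  countUpTo c g (suc n) ≡ (c == g 0) + countUpTo c (λ k → g (suc k)) n
countUpTo-suc c g zero = +-comm 0 (c == g 0)
countUpTo-suc c g (suc n) = trans (cong (_+ (c == g (suc n))) (countUpTo-suc c g n)) (+-assoc (c == g 0) _ _)

countUpTo-cong : ∀ c {g h : ℕ → Letter} m → (∀ k → k < m → g k ≡ h k) → countUpTo c g m ≡ countUpTo c h m
countUpTo-cong c zero g≡h = refl
countUpTo-cong c (suc m) g≡h =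
  cong₂ _+_ (countUpTo-cong c m (λ k k<m → g≡h k (m<n⇒m<1+n k<m))) (cong (c ==_) (g≡h m (n<1+n m)))

countUpTo-𝕒+𝕓 : ∀ (g : ℕ → Letter) m → countUpTo 𝕒 g m + countUpTo 𝕓 g m ≡ m
countUpTo-𝕒+𝕓 g zero = refl
countUpTo-𝕒+𝕓 g (suc m) = begin
  (countUpTo 𝕒 g m + (𝕒 == g m)) + (countUpTo 𝕓 g m + (𝕓 == g m))
    ≡⟨ interchange (countUpTo 𝕒 g m) _ _ _ ⟩
  (countUpTo 𝕒 g m + countUpTo 𝕓 g m) + ((𝕒 == g m) + (𝕓 == g m))
    ≡⟨ cong₂ _+_ (countUpTo-𝕒+𝕓 g m) (==-𝕒+𝕓 (g m)) ⟩
  m + 1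
    ≡⟨ +-comm m 1 ⟩
  suc m ∎
  where
  ==-𝕒+𝕓 : ∀ x → (𝕒 == x) + (𝕓 == x) ≡ 1
  ==-𝕒+𝕓 𝕒 = refl
  ==-𝕒+𝕓 𝕓 = refl

IsNthPos-prepend : ∀ u {v g c n m} → IsNthPos (prepend v g) c n m →
  IsNthPos (prepend (u ++ v) g) c (countL c u + n) (length u + m)
IsNthPos-prepend [] p = p
IsNthPos-prepend (x ∷ u) {v} {g} {c} {n} {m} p with at , count ← IsNthPos-prepend u p = at , (begin
  suc (countUpTo c (prepend (x ∷ u ++ v) g) (suc (length u + m)))
    ≡⟨ cong suc (countUpTo-suc c (prepend (x ∷ u ++ v) g) (length u + m)) ⟩
  suc ((c == x) + countUpTo c (prepend (u ++ v) g) (length u + m))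
    ≡⟨ sym (+-suc (c == x) _) ⟩
  (c == x) + suc (countUpTo c (prepend (u ++ v) g) (length u + m))
    ≡⟨ cong (λ k → (c == x) + k) count ⟩
  (c == x) + (countL c u + n)
    ≡⟨ sym (+-assoc (c == x) (countL c u) n) ⟩
  (c == x) + countL c u + n ∎)

+[k+m]-+[k+n]≡+m-+n : ∀ k m n → (+ (k + m)) - (+ (k + n)) ≡ (+ m) - (+ n)
+[k+m]-+[k+n]≡+m-+n k m n = begin
  (+ (k + m)) - (+ (k + n)) ≡⟨ m-n≡m⊖n (k + m) (k + n) ⟩
  (k + m) ⊖ (k + n)         ≡⟨ +-cancelˡ-⊖ k m n ⟩
  m ⊖ n                     ≡⟨ sym (m-n≡m⊖n m n) ⟩
  (+ m) - (+ n)             ∎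

+[m+n]-+m≡+n : ∀ m n → (+ (m + n)) - (+ m) ≡ + n
+[m+n]-+m≡+n m n = begin
  (+ (m + n)) - (+ m) ≡⟨ m-n≡m⊖n (m + n) m ⟩
  (m + n) ⊖ m         ≡⟨ ⊖-≥ (m≤m+n m n) ⟩
  + (m + n ∸ m)       ≡⟨ cong +_ (m+n∸m≡n m n) ⟩
  + n                 ∎

r-prepend : ∀ u {v g n r} → countL 𝕒 u ≡ countL 𝕓 u →
  RIs (prepend v g) n r → RIs (prepend (u ++ v) g) (countL 𝕒 u + n) r
r-prepend u {v} {g} {n} balanced (pa , pb , a-pos , b-pos , r≡) =
  length u + pa , length u + pb ,
  IsNthPos-prepend u a-pos ,
  subst (λ k → IsNthPos (prepend (u ++ v) g) 𝕓 (k + n) (length u + pb)) (sym balanced)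
        (IsNthPos-prepend u b-pos) ,
  trans (+[k+m]-+[k+n]≡+m-+n (length u) pb pa) r≡

r-abPow : ∀ g {n j} → 1 ≤ n → n ≤ j → RIs (prepend (abPow j) g) n (+ 1)
r-abPow g {1} {suc j} _ _ = 0 , 1 , (refl , refl) , (refl , refl) , refl
r-abPow g {suc (suc n)} {suc j} _ (s≤s n<j) = r-prepend (𝕒 ∷ 𝕓 ∷ []) refl (r-abPow g (s≤s z≤n) n<j)

infix 4 _[_]=_
data _[_]=_ : List Letter → ℕ → Letter → Set where
  here  : ∀ {x w} → (x ∷ w) [ zero ]= x
  there : ∀ {y w i x} → w [ i ]= x → (y ∷ w) [ suc i ]= x

[]=-functional : ∀ {w i x y} → w [ i ]= x → w [ i ]= y → x ≡ y
[]=-functional here here = refl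
[]=-functional (there p) (there q) = []=-functional p q

nth-[]= : ∀ w {i} → i < length w → w [ i ]= nth w i
nth-[]= (x ∷ w) {zero} _ = here
nth-[]= (x ∷ w) {suc i} (s≤s i<n) = there (nth-[]= w i<n)

[]=-++ : ∀ {xs i x} ys → xs [ i ]= x → (xs ++ ys) [ i ]= x
[]=-++ ys here = here
[]=-++ ys (there p) = there ([]=-++ ys p)

-- Each 𝕒 before position i of g is sent to two letters and each 𝕓 to one,
-- so ϱF(g) has the block ϱF(g i) at this position.
ϱF-pos : (ℕ → Letter) → ℕ → ℕ
ϱF-pos g i = i + countUpTo 𝕒 g i

ϱF-pos-suc-𝕒 : ∀ {g} i → g i ≡ 𝕒 → ϱF-pos g (suc i) ≡ suc (suc (ϱF-pos g i))
ϱF-pos-suc-𝕒 {g} i gi≡𝕒 = cong suc (begin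
  i + (countUpTo 𝕒 g i + (𝕒 == g i)) ≡⟨ cong (λ x → i + (countUpTo 𝕒 g i + (𝕒 == x))) gi≡𝕒 ⟩
  i + (countUpTo 𝕒 g i + 1)          ≡⟨ cong (λ k → i + k) (+-comm _ 1) ⟩
  i + suc (countUpTo 𝕒 g i)          ≡⟨ +-suc i _ ⟩
  suc (ϱF-pos g i)                   ∎)

ϱF-pos-suc-𝕓 : ∀ {g} i → g i ≡ 𝕓 → ϱF-pos g (suc i) ≡ suc (ϱF-pos g i)
ϱF-pos-suc-𝕓 {g} i gi≡𝕓 = cong suc (begin
  i + (countUpTo 𝕒 g i + (𝕒 == g i)) ≡⟨ cong (λ x → i + (countUpTo 𝕒 g i + (𝕒 == x))) gi≡𝕓 ⟩
  i + (countUpTo 𝕒 g i + 0)          ≡⟨ cong (λ k → i + k) (+-identityʳ _) ⟩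
  ϱF-pos g i                         ∎)

ϱF-[]=-𝕒 : ∀ {w i x} → w [ i ]= x → ϱF w [ ϱF-pos (nth w) i ]= 𝕒
ϱF-[]=-𝕒 (here {𝕒}) = here
ϱF-[]=-𝕒 (here {𝕓}) = here
ϱF-[]=-𝕒 (there {𝕒} {w} {i} p)
  rewrite countUpTo-suc 𝕒 (nth (𝕒 ∷ w)) i | +-suc i (countUpTo 𝕒 (nth w) i) = there (there (ϱF-[]=-𝕒 p))
ϱF-[]=-𝕒 (there {𝕓} {w} {i} p)
  rewrite countUpTo-suc 𝕒 (nth (𝕓 ∷ w)) i = there (ϱF-[]=-𝕒 p)

ϱF-[]=-𝕓 : ∀ {w i} → w [ i ]= 𝕒 → ϱF w [ suc (ϱF-pos (nth w) i) ]= 𝕓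
ϱF-[]=-𝕓 here = there here
ϱF-[]=-𝕓 (there {𝕒} {w} {i} p)
  rewrite countUpTo-suc 𝕒 (nth (𝕒 ∷ w)) i | +-suc i (countUpTo 𝕒 (nth w) i) = there (there (ϱF-[]=-𝕓 p))
ϱF-[]=-𝕓 (there {𝕓} {w} {i} p)
  rewrite countUpTo-suc 𝕒 (nth (𝕓 ∷ w)) i = there (ϱF-[]=-𝕓 p)

ϱF-++ : ∀ xs ys → ϱF (xs ++ ys) ≡ ϱF xs ++ ϱF ys
ϱF-++ [] ys = refl
ϱF-++ (𝕒 ∷ xs) ys = cong (λ w → 𝕒 ∷ 𝕓 ∷ w) (ϱF-++ xs ys)
ϱF-++ (𝕓 ∷ xs) ys = cong (𝕒 ∷_) (ϱF-++ xs ys)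

length-ϱF-≥ : ∀ w → length w ≤ length (ϱF w)
length-ϱF-≥ [] = z≤n
length-ϱF-≥ (𝕒 ∷ w) = m≤n⇒m≤1+n (s≤s (length-ϱF-≥ w))
length-ϱF-≥ (𝕓 ∷ w) = s≤s (length-ϱF-≥ w)

length-ϱF-> : ∀ {w} → w [ 0 ]= 𝕒 → length w < length (ϱF w)
length-ϱF-> (here {w = w}) = s≤s (s≤s (length-ϱF-≥ w))

iterϱ-prefix : ∀ k → Σ (List Letter) λ zs → iterϱ (suc k) ≡ iterϱ k ++ zs
iterϱ-prefix zero = 𝕓 ∷ [] , refl
iterϱ-prefix (suc k) with zs , eq ← iterϱ-prefix k = ϱF zs , trans (cong ϱF eq) (ϱF-++ (iterϱ k) zs)

iterϱ-[]=-mono : ∀ {k m i x} → k ≤′ m → iterϱ k [ i ]= x → iterϱ m [ i ]= x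
iterϱ-[]=-mono ≤′-refl p = p
iterϱ-[]=-mono {m = suc m} {i} {x} (≤′-step k≤m) p with zs , eq ← iterϱ-prefix m =
  subst (_[ i ]= x) (sym eq) ([]=-++ zs (iterϱ-[]=-mono k≤m p))

iterϱ-length : ∀ k → k < length (iterϱ k)
iterϱ-length zero = s≤s z≤n
iterϱ-length (suc k) = ≤-trans (s≤s (iterϱ-length k)) (length-ϱF-> (iterϱ-[]=-mono (z≤′n {k}) here))

fib-[]= : ∀ k {i x} → iterϱ k [ i ]= x → fib i ≡ x
fib-[]= k {i} p = []=-functional
  (iterϱ-[]=-mono (≤⇒≤′ (m≤n⊔m k (suc i))) (nth-[]= (iterϱ (suc i)) (<-trans (n<1+n i) (iterϱ-length (suc i)))))
  (iterϱ-[]=-mono (≤⇒≤′ (m≤m⊔n k (suc i))) p)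

iterϱ-[]=-fib : ∀ k {i} → i < length (iterϱ k) → iterϱ k [ i ]= fib i
iterϱ-[]=-fib k {i} i<n = subst (iterϱ k [ i ]=_) (sym (fib-[]= k p)) p
  where
  p : iterϱ k [ i ]= nth (iterϱ k) i
  p = nth-[]= (iterϱ k) i<n

ϱF-pos-iterϱ : ∀ i → ϱF-pos (nth (iterϱ i)) i ≡ ϱF-pos fib i
ϱF-pos-iterϱ i = cong (λ k → i + k) (countUpTo-cong 𝕒 i (λ k k<i →
  sym (fib-[]= i (nth-[]= (iterϱ i) (<-trans k<i (iterϱ-length i))))))

fib-ϱF-pos : ∀ i → fib (ϱF-pos fib i) ≡ 𝕒
fib-ϱF-pos i = fib-[]= (suc i) (subst (iterϱ (suc i) [_]= 𝕒) (ϱF-pos-iterϱ i)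
  (ϱF-[]=-𝕒 (iterϱ-[]=-fib i (iterϱ-length i))))

fib-suc-ϱF-pos : ∀ i → fib i ≡ 𝕒 → fib (suc (ϱF-pos fib i)) ≡ 𝕓
fib-suc-ϱF-pos i fi≡𝕒 = fib-[]= (suc i) (subst (λ p → iterϱ (suc i) [ suc p ]= 𝕓) (ϱF-pos-iterϱ i)
  (ϱF-[]=-𝕓 (subst (iterϱ i [ i ]=_) fi≡𝕒 (iterϱ-[]=-fib i (iterϱ-length i)))))

countUpTo-𝕒-ϱF-pos : ∀ i → countUpTo 𝕒 fib (ϱF-pos fib i) ≡ i
countUpTo-𝕒-ϱF-pos zero = refl
countUpTo-𝕒-ϱF-pos (suc i) = begin
  countUpTo 𝕒 fib (ϱF-pos fib (suc i))  ≡⟨ block-ends-with-𝕒 refl ⟩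
  countUpTo 𝕒 fib (suc (ϱF-pos fib i))  ≡⟨ cong₂ _+_ (countUpTo-𝕒-ϱF-pos i) (cong (𝕒 ==_) (fib-ϱF-pos i)) ⟩
  i + 1                                  ≡⟨ +-comm i 1 ⟩
  suc i                                  ∎
  where
  block-ends-with-𝕒 : ∀ {x} → fib i ≡ x →
    countUpTo 𝕒 fib (ϱF-pos fib (suc i)) ≡ countUpTo 𝕒 fib (suc (ϱF-pos fib i))
  block-ends-with-𝕒 {𝕓} fi≡𝕓 = cong (countUpTo 𝕒 fib) (ϱF-pos-suc-𝕓 i fi≡𝕓)
  block-ends-with-𝕒 {𝕒} fi≡𝕒 = begin
    countUpTo 𝕒 fib (ϱF-pos fib (suc i))           ≡⟨ cong (countUpTo 𝕒 fib) (ϱF-pos-suc-𝕒 i fi≡𝕒) ⟩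
    countUpTo 𝕒 fib (suc (ϱF-pos fib i)) + (𝕒 == fib (suc (ϱF-pos fib i)))
      ≡⟨ cong (λ x → countUpTo 𝕒 fib (suc (ϱF-pos fib i)) + (𝕒 == x)) (fib-suc-ϱF-pos i fi≡𝕒) ⟩
    countUpTo 𝕒 fib (suc (ϱF-pos fib i)) + 0      ≡⟨ +-identityʳ _ ⟩
    countUpTo 𝕒 fib (suc (ϱF-pos fib i))           ∎

countUpTo-𝕓-ϱF-pos : ∀ i → countUpTo 𝕓 fib (ϱF-pos fib i) ≡ countUpTo 𝕒 fib i
countUpTo-𝕓-ϱF-pos i = +-cancelˡ-≡ i _ _ (begin
  i + countUpTo 𝕓 fib (ϱF-pos fib i)
    ≡⟨ cong (_+ countUpTo 𝕓 fib (ϱF-pos fib i)) (sym (countUpTo-𝕒-ϱF-pos i)) ⟩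
  countUpTo 𝕒 fib (ϱF-pos fib i) + countUpTo 𝕓 fib (ϱF-pos fib i)
    ≡⟨ countUpTo-𝕒+𝕓 fib (ϱF-pos fib i) ⟩
  ϱF-pos fib i ∎)

r-fib : ∀ {n} → 1 ≤ n → RIs fib n (+ n)
r-fib {suc i} _ = pa , pb , (fib-ϱF-pos i , cong suc (countUpTo-𝕒-ϱF-pos i)) , (b-at , b-count) , r≡
  where
  pa pb : ℕ
  pa = ϱF-pos fib i
  pb = suc (ϱF-pos fib pa)
  b-at : fib pb ≡ 𝕓
  b-at = fib-suc-ϱF-pos pa (fib-ϱF-pos i)
  b-count : suc (countUpTo 𝕓 fib pb) ≡ suc i
  b-count = cong suc (begin
    countUpTo 𝕓 fib (ϱF-pos fib pa) + (𝕓 == fib (ϱF-pos fib pa))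
      ≡⟨ cong₂ _+_ (trans (countUpTo-𝕓-ϱF-pos pa) (countUpTo-𝕒-ϱF-pos i)) (cong (𝕓 ==_) (fib-ϱF-pos pa)) ⟩
    i + 0 ≡⟨ +-identityʳ i ⟩
    i ∎)
  r≡ : (+ pb) - (+ pa) ≡ + suc i
  r≡ = begin
    (+ suc (pa + countUpTo 𝕒 fib pa)) - (+ pa) ≡⟨ cong (λ k → (+ suc (pa + k)) - (+ pa)) (countUpTo-𝕒-ϱF-pos i) ⟩
    (+ suc (pa + i)) - (+ pa)                  ≡⟨ cong (λ k → (+ k) - (+ pa)) (sym (+-suc pa i)) ⟩
    (+ (pa + suc i)) - (+ pa)                  ≡⟨ +[m+n]-+m≡+n pa (suc i) ⟩
    + suc i                                    ∎

theorem4p18 : (j : ℕ) → 1 ≤ j → (u : List Letter) →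
    length u ≡ 2 * j → countL 𝕒 u ≡ j → countL 𝕓 u ≡ j →
    ((n : ℕ) → j < n → RIs (prepend u fib) n ((+ n) - (+ j)))
    × (u ≡ abPow j → (n : ℕ) → 1 ≤ n → n ≤ j → RIs (prepend u fib) n (+ 1))
theorem4p18 j _ u _ #𝕒≡j #𝕓≡j = beyond-j , up-to-j
  where
  beyond-j : (n : ℕ) → j < n → RIs (prepend u fib) n ((+ n) - (+ j))
  beyond-j n j<n = subst₂ (RIs (prepend u fib)) index value
    (subst (λ w → RIs (prepend w fib) (countL 𝕒 u + (n ∸ j)) (+ (n ∸ j))) (++-identityʳ u)
      (r-prepend u (trans #𝕒≡j (sym #𝕓≡j)) (r-fib (m<n⇒0<n∸m j<n))))
    where
    index : countL 𝕒 u + (n ∸ j) ≡ n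
    index = trans (cong (_+ (n ∸ j)) #𝕒≡j) (m+[n∸m]≡n (<⇒≤ j<n))
    value : + (n ∸ j) ≡ (+ n) - (+ j)
    value = sym (trans (m-n≡m⊖n n j) (⊖-≥ (<⇒≤ j<n)))
  up-to-j : u ≡ abPow j → (n : ℕ) → 1 ≤ n → n ≤ j → RIs (prepend u fib) n (+ 1)
  up-to-j u≡abPow n 1≤n n≤j = subst (λ w → RIs (prepend w fib) n (+ 1)) (sym u≡abPow) (r-abPow fib 1≤n n≤j)
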